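{- Let $n$ and $k$ be integers with $2 \leq k \leq n-2$, and let $(I_1, I_2, \dots, I_n)$ be a Grassmann necklace with $|I_t| = k$ for all $t$. The positroid $M = \bigcap_{t=1}^n SM^t_{I_t}$ on ground set $[n]$ (of rank $k$) is sparse paving if and only if for every $i \in [n]$, $I_i \neq C_{k,n}^{(i)}$ implies that $I_{i-1} = C_{k,n}^{(i-1)}$, $I_{i+1} = C_{k,n}^{(i+1)}$, and $I_i = (C_{k,n}^{(i)} \setminus \{i + k - 1\}) \cup \{i+k\}$ (all indices modulo $n$ with representatives in $[n]$). Moreover, in this case, the set of circuit-hyperplanes of $M$ consists precisely of the sets $C_{k,n}^{(i)}$ for those $i\in[n]$ with $I_i \neq C_{k,n}^{(i)}$.
   Context: For $t \in [n]=\{1,\dots,n\}$, the order $<_t$ on $[n]$ is $t <_t t+1 <_t \cdots <_t n <_t 1 <_t \cdots <_t t-1$. For $k$-subsets $I=\{a_1<_t\cdots<_t a_k\}$, $J=\{b_1<_t\cdots<_t b_k\}$ write $I\le_t J$ if $a_i\le_t b_i$ for all $i$. A Grassmann necklace is a sequence $(I_1,\dots,I_n)$ of subsets of $[n]$ (indices mod $n$) such that if $i\in I_i$ then $I_{i+1}=(I_i\setminus\{i\})\cup\{j\}$ for some $j\in[n]$, and if $i\notin I_i$ then $I_{i+1}=I_i$. The cyclically shifted Schubert matroid $SM^t_I$ (for $I$ a $k$-subset) is the matroid on $[n]$ with bases $\{J\in\binom{[n]}{k}: I\le_t J\}$; the positroid of the necklace is the matroid on $[n]$ whose set of bases is the intersection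 of the basis sets of $SM^t_{I_t}$, $t=1,\dots,n$. For $i\in[n]$, $C_{k,n}^{(i)}=\{i,i+1,\dots,i+k-1\}$ computed modulo $n$ with representatives in $[n]$ (the cyclic interval of length $k$ starting at $i$). A rank-$k$ matroid is paving if every circuit has cardinality at least $k$, and sparse paving if it and its dual are both paving. A circuit-hyperplane is a set that is both a circuit and a hyperplane. -}

module Defs where

open import Data.Nat using (ℕ; zero; suc; _+_; _∸_; _≤_; _<_; _<?_; _≤ᵇ_)
open import Data.Fin using (Fin; toℕ; fromℕ; fromℕ<; inject₁)
  renaming (zero to fzero; suc to fsuc)
open import Data.Fin.Subset using (Subset; ⁅_⁆; _∪_; _-_; ∣_∣; ∁; _∈_; _∉_; _⊆_; _⊂_; ⊥)
open import Data.Fin.Subset.Properties using (_∈?_)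
open import Data.Bool using (true; false)
open import Data.List using (List; map; filter; upTo)
open import Data.List.Relation.Binary.Pointwise using (Pointwise)
open import Data.Product using (Σ; ∃; _×_)
open import Relation.Nullary using (¬_; yes; no)
open import Relation.Binary.PropositionalEquality using (_≡_)

-- Ground set [n] is modelled by Fin n; the element a : Fin n stands for
-- the element (toℕ a + 1) of [n] = {1,...,n}.

next : ∀ {n} → Fin n → Fin n
next {suc m} i with suc (toℕ i) <? suc m
... | yes p = fromℕ< p
... | no _  = fzero

prev : ∀ {n} → Fin n → Fin n
prev {suc m} fzero    = fromℕ m
prev {suc m} (fsuc i) = inject₁ i

shift : ∀ {n} → Fin n → ℕ → Fin n
shift i zero    = i
shift i (suc j) = shift (next i) j

-- position of a in the order <_t : number of cyclic steps from t to a
pos : ∀ {n} → Fin n → Fin n → ℕ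
pos {n} t a with toℕ t ≤ᵇ toℕ a
... | true  = toℕ a ∸ toℕ t
... | false = (n + toℕ a) ∸ toℕ t

_≤[_]_ : ∀ {n} → Fin n → Fin n → Fin n → Set
a ≤[ t ] b = pos t a ≤ pos t b

orderList : ∀ {n} → Fin n → List (Fin n)
orderList {n} t = map (shift t) (upTo n)

sortedBy : ∀ {n} → Fin n → Subset n → List (Fin n)
sortedBy t I = filter (_∈? I) (orderList t)

GaleLe : ∀ {n} → Fin n → Subset n → Subset n → Set
GaleLe t I J = Pointwise (λ a b → a ≤[ t ] b) (sortedBy t I) (sortedBy t J)

IsGrassmannNecklace : ∀ {n} → (Fin n → Subset n) → Set
IsGrassmannNecklace {n} I = ∀ (i : Fin n) →
  (i ∈ I i → ∃ λ (j : Fin n) → I (next i) ≡ ((I i - i) ∪ ⁅ j ⁆)) ×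
  (i ∉ I i → I (next i) ≡ I i)

SchubertBasis : ∀ {n} → ℕ → Fin n → Subset n → Subset n → Set
SchubertBasis k t I J = (∣ J ∣ ≡ k) × GaleLe t I J

PositroidBasis : ∀ {n} → ℕ → (Fin n → Subset n) → Subset n → Set
PositroidBasis {n} k I J = ∀ (t : Fin n) → SchubertBasis k t (I t) J

cycInterval : ∀ {n} → ℕ → Fin n → Subset n
cycInterval zero    i = ⊥
cycInterval (suc k) i = ⁅ i ⁆ ∪ cycInterval k (next i)

module _ {n : ℕ} (B : Subset n → Set) where

  Independent : Subset n → Set
  Independent X = ∃ λ Y → B Y × X ⊆ Y

  Dependent : Subset n → Set
  Dependent X = ¬ Independent X

  Circuit : Subset n → Set
  Circuit C = Dependent C × (∀ Y → Y ⊂ C → Independent Y)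

  HasRank : Subset n → ℕ → Set
  HasRank X m = (∃ λ Y → Y ⊆ X × Independent Y × ∣ Y ∣ ≡ m)
              × (∀ Y → Y ⊆ X → Independent Y → ∣ Y ∣ ≤ m)

  Flat : Subset n → Set
  Flat F = ∀ e → e ∉ F → ∀ m m' → HasRank F m → HasRank (F ∪ ⁅ e ⁆) m' → m < m'

  Hyperplane : ℕ → Subset n → Set
  Hyperplane r H = Flat H × HasRank H (r ∸ 1)

  CircuitHyperplane : ℕ → Subset n → Set
  CircuitHyperplane r X = Circuit X × Hyperplane r X

  Paving : ℕ → Set
  Paving r = ∀ C → Circuit C → r ≤ ∣ C ∣

dualBases : ∀ {n} → (Subset n → Set) → Subset n → Set
dualBases B X = B (∁ X)

SparsePaving : ∀ {n} → (Subset n → Set) → ℕ → Set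
SparsePaving {n} B r = Paving B r × Paving (dualBases B) (n ∸ r)

NecklaceCond : ∀ {n} → ℕ → (Fin n → Subset n) → Set
NecklaceCond {n} k I = ∀ (i : Fin n) → ¬ (I i ≡ cycInterval k i) →
    (I (prev i) ≡ cycInterval k (prev i))
  × (I (next i) ≡ cycInterval k (next i))
  × (I i ≡ ((cycInterval k i - shift i (k ∸ 1)) ∪ ⁅ shift i k ⁆))

-- Comparing k-sets in the Gale order ≤_t amounts to comparing, entry by entry, the increasing
-- lists of offsets j with t + j in the set.  In these terms the interval C_{k,n}^{(t)} is the
-- ≤_t-least k-set, and its bump (C_{k,n}^{(t)} - {t+k-1}) ∪ {t+k} lies ≤_t below every k-set
-- except C_{k,n}^{(t)} itself.
--
-- If M is sparse paving, the (k-1)-set C_{k-1,n}^{(t)} is independent, so it lies in I_t;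
-- dually the complement of C_{k+1,n}^{(t)} is co-independent, so I_t ⊆ C_{k+1,n}^{(t)}.  Hence I_t
-- is the interval or its bump, and two bumps are never consecutive because the necklace step
-- keeps t+k in I_{t+1}.
--
-- Conversely, under the condition the non-bases are exactly the intervals C_{k,n}^{(t)} with I_t
-- defective.  Two k-intervals differing in one element are consecutive (as k + 2 ≤ n) and
-- consecutive indices are never both defective, so no single exchange links two non-bases.  This
-- makes every set of size < k independent, every set of size < n - k co-independent, and each
-- defective interval a circuit-hyperplane.

module Submission where

open import Defs
open import Data.Bool using (true; false; T) renaming (_≟_ to _≟ᵇ_)
open import Data.Empty using (⊥; ⊥-elim)
open import Data.Fin using (Fin; toℕ; inject₁) renaming (zero to fzero; suc to fsuc)
open import Data.Fin.Properties using (toℕ-injective; toℕ-fromℕ<; toℕ<n; toℕ-fromℕ; toℕ-inject₁; any?; all?; ¬∀⟶∃¬)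
  renaming (_≟_ to _≟ᶠ_)
open import Data.Fin.Subset using (Subset; ⁅_⁆; _∪_; _-_; _─_; ∣_∣; ∁; _∈_; _∉_; _⊆_; _⊂_; ⊤; inside; outside)
  renaming (⊥ to ∅)
open import Data.Fin.Subset.Properties
open import Data.List using (List; []; _∷_; _++_; [_]; length; map; filter; upTo; applyUpTo)
open import Data.List.Properties using (filter-all; filter-none; filter-++; filter-accept; filter-reject; filter-notAll; ++-identityʳ)
open import Data.List.Membership.Propositional.Properties using (∈-filter⁺; ∈-filter⁻)
open import Data.List.Relation.Binary.Pointwise using (Pointwise; []; _∷_; map⁺; map⁻)
open import Data.List.Relation.Binary.Pointwise.Properties using (decidable)
open import Data.List.Relation.Unary.All as All using (All; []; _∷_)
open import Data.List.Relation.Unary.All.Properties using (filter⁺; all-filter)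
open import Data.List.Relation.Unary.Any using (Any; here; there)
open import Data.Nat using (ℕ; zero; suc; _+_; _∸_; _≤_; _<_; _<?_; _≤ᵇ_; _≤?_; _≟_; z≤n; s≤s; s≤s⁻¹)
open import Data.Nat.Properties
open import Data.Product using (∃; _×_; _,_; proj₁; proj₂)
open import Data.Sum using (_⊎_; inj₁; inj₂; [_,_]′)
open import Data.Unit using (tt)
open import Data.Vec using (_∷_; here; there)
open import Data.Vec.Properties using (≡-dec)
open import Function using (_∘_; id)
open import Function.Bundles using (_⇔_; mk⇔)
open import Level using (0ℓ)
open import Relation.Binary.PropositionalEquality hiding ([_])
open import Relation.Nullary using (¬_; yes; no; Dec; does)
open import Relation.Nullary.Decidable using (_×-dec_; ¬?; decidable-stable)
open import Relation.Unary using (Pred; Decidable)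

private
  variable
    m : ℕ

-- Cyclic arithmetic

toℕ-next : (t : Fin (suc m)) → suc (toℕ t) < suc m → toℕ (next t) ≡ suc (toℕ t)
toℕ-next {m} t lt with suc (toℕ t) <? suc m
... | yes p = toℕ-fromℕ< p
... | no ¬p = ⊥-elim (¬p lt)

next-last : (t : Fin (suc m)) → toℕ t ≡ m → next t ≡ fzero
next-last {m} t t≡m with suc (toℕ t) <? suc m
... | yes p = ⊥-elim (<-irrefl t≡m (s≤s⁻¹ p))
... | no _  = refl

shift-+ : ∀ {n} (t : Fin n) a b → shift t (a + b) ≡ shift (shift t a) b
shift-+ t zero    b = refl
shift-+ t (suc a) b = shift-+ (next t) a b

shift-suc : ∀ {n} (t : Fin n) j → shift t (suc j) ≡ next (shift t j)
shift-suc t j = trans (cong (shift t) (+-comm 1 j)) (shift-+ t j 1)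

toℕ-shift : (t : Fin (suc m)) (j : ℕ) → toℕ t + j < suc m → toℕ (shift t j) ≡ toℕ t + j
toℕ-shift t zero    _  = sym (+-identityʳ _)
toℕ-shift {m} t (suc j) lt = begin
  toℕ (shift (next t) j)  ≡⟨ toℕ-shift (next t) j (subst (λ z → z + j < suc m) (sym next≡) lt′) ⟩
  toℕ (next t) + j        ≡⟨ cong (_+ j) next≡ ⟩
  suc (toℕ t) + j         ≡⟨ +-suc (toℕ t) j ⟨
  toℕ t + suc j           ∎
  where
  open ≡-Reasoning
  lt′ : suc (toℕ t) + j < suc m
  lt′ = subst (_< suc m) (+-suc (toℕ t) j) lt
  next≡ : toℕ (next t) ≡ suc (toℕ t)
  next≡ = toℕ-next t (≤-<-trans (m≤m+n (suc (toℕ t)) j) lt′)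

shift-wrap : (t : Fin (suc m)) (j : ℕ) → toℕ t + j ≡ suc m → shift t j ≡ fzero
shift-wrap t zero    eq = ⊥-elim (<-irrefl (trans (sym (+-identityʳ _)) eq) (toℕ<n t))
shift-wrap {m} t (suc j) eq =
  trans (shift-suc t j) (next-last (shift t j) (trans (toℕ-shift t j lt) (suc-injective (trans (sym (+-suc _ _)) eq))))
  where
  lt : toℕ t + j < suc m
  lt = subst (toℕ t + j <_) eq (subst (toℕ t + j <_) (sym (+-suc (toℕ t) j)) ≤-refl)

shift-past-wrap : (t : Fin (suc m)) (j : ℕ) → shift t ((suc m ∸ toℕ t) + j) ≡ shift fzero j
shift-past-wrap {m} t j = trans (shift-+ t (suc m ∸ toℕ t) j)
  (cong (λ z → shift z j) (shift-wrap t _ (m+[n∸m]≡n (<⇒≤ (toℕ<n t)))))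

shift-period : (t : Fin (suc m)) → shift t (suc m) ≡ t
shift-period {m} t = toℕ-injective (begin
  toℕ (shift t (suc m))                   ≡⟨ cong (toℕ ∘ shift t) (m∸n+n≡m (<⇒≤ (toℕ<n t))) ⟨
  toℕ (shift t ((suc m ∸ toℕ t) + toℕ t))  ≡⟨ cong toℕ (shift-past-wrap t (toℕ t)) ⟩
  toℕ (shift fzero (toℕ t))               ≡⟨ toℕ-shift fzero (toℕ t) (toℕ<n t) ⟩
  toℕ t                                   ∎)
  where open ≡-Reasoning

pos-≤ : ∀ {n} (t a : Fin n) → toℕ t ≤ toℕ a → pos t a ≡ toℕ a ∸ toℕ t
pos-≤ t a t≤a with toℕ t ≤ᵇ toℕ a in eq
... | true  = refl
... | false = ⊥-elim (subst T eq (≤⇒≤ᵇ t≤a))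

pos-> : ∀ {n} (t a : Fin n) → toℕ a < toℕ t → pos t a ≡ (n + toℕ a) ∸ toℕ t
pos-> t a a<t with toℕ t ≤ᵇ toℕ a in eq
... | true  = ⊥-elim (<⇒≱ a<t (≤ᵇ⇒≤ _ _ (subst T (sym eq) tt)))
... | false = refl

+-∸-< : ∀ n a t → a < t → t ≤ n → (n + a) ∸ t < n
+-∸-< (suc n) zero    (suc t) _         _   = subst (λ z → z ∸ suc t < suc n) (sym (+-identityʳ (suc n))) (s≤s (m∸n≤m n t))
+-∸-< n       (suc a) (suc t) (s≤s a<t) t≤n =
  subst (λ z → z ∸ suc t < n) (sym (+-suc n a)) (+-∸-< n a t a<t (≤-trans (n≤1+n t) t≤n))

pos<n : ∀ {n} (t a : Fin n) → pos t a < n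
pos<n {n} t a with toℕ t ≤? toℕ a
... | yes t≤a = subst (_< n) (sym (pos-≤ t a t≤a)) (≤-<-trans (m∸n≤m (toℕ a) (toℕ t)) (toℕ<n a))
... | no  t≰a = subst (_< n) (sym (pos-> t a (≰⇒> t≰a))) (+-∸-< n (toℕ a) (toℕ t) (≰⇒> t≰a) (<⇒≤ (toℕ<n t)))

pos-shift : (t : Fin (suc m)) (j : ℕ) → j < suc m → pos t (shift t j) ≡ j
pos-shift {m} t j j<n with toℕ t + j <? suc m
... | yes lt = trans (pos-≤ t (shift t j) (subst (toℕ t ≤_) (sym eq) (m≤m+n _ _)))
                 (trans (cong (_∸ toℕ t) eq) (m+n∸m≡n (toℕ t) j))
  where eq = toℕ-shift t j lt
... | no ¬lt = begin
  pos t (shift t j)                  ≡⟨ cong (pos t) wrapped ⟩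
  pos t (shift fzero r)              ≡⟨ pos-> t (shift fzero r) (subst (_< u) (sym r≡) r<u) ⟩
  (suc m + toℕ (shift fzero r)) ∸ u  ≡⟨ cong (λ z → (suc m + z) ∸ u) r≡ ⟩
  (suc m + r) ∸ u                    ≡⟨ cong (_∸ u) n+r≡u+j ⟩
  (u + j) ∸ u                        ≡⟨ m+n∸m≡n u j ⟩
  j                                  ∎
  where
  open ≡-Reasoning
  u = toℕ t
  d = suc m ∸ u
  u+d : u + d ≡ suc m
  u+d = m+[n∸m]≡n (<⇒≤ (toℕ<n t))
  d≤j : d ≤ j
  d≤j = +-cancelˡ-≤ u d j (subst (_≤ u + j) (sym u+d) (≮⇒≥ ¬lt))
  r = j ∸ d
  d+r : d + r ≡ j
  d+r = m+[n∸m]≡n d≤j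
  wrapped : shift t j ≡ shift fzero r
  wrapped = trans (cong (shift t) (sym d+r)) (shift-past-wrap t r)
  r≡ : toℕ (shift (fzero {m}) r) ≡ r
  r≡ = toℕ-shift fzero r (≤-<-trans (m∸n≤m j d) j<n)
  r<u : r < u
  r<u = +-cancelʳ-< d r u (subst₂ _<_ (sym (trans (+-comm r d) d+r)) (sym u+d) j<n)
  n+r≡u+j : suc m + r ≡ u + j
  n+r≡u+j = trans (cong (_+ r) (sym u+d)) (trans (+-assoc u d r) (cong (u +_) d+r))

shift-pos : (t a : Fin (suc m)) → shift t (pos t a) ≡ a
shift-pos {m} t a with toℕ t ≤? toℕ a
... | yes t≤a = toℕ-injective (begin
  toℕ (shift t (pos t a))        ≡⟨ cong (toℕ ∘ shift t) (pos-≤ t a t≤a) ⟩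
  toℕ (shift t (toℕ a ∸ toℕ t))  ≡⟨ toℕ-shift t _ (subst (_< suc m) (sym eq) (toℕ<n a)) ⟩
  toℕ t + (toℕ a ∸ toℕ t)        ≡⟨ eq ⟩
  toℕ a                          ∎)
  where
  open ≡-Reasoning
  eq = m+[n∸m]≡n t≤a
... | no t≰a = toℕ-injective (begin
  toℕ (shift t (pos t a))            ≡⟨ cong (toℕ ∘ shift t) (trans (pos-> t a (≰⇒> t≰a)) n+a∸u) ⟩
  toℕ (shift t (d + toℕ a))          ≡⟨ cong toℕ (shift-past-wrap t (toℕ a)) ⟩
  toℕ (shift fzero (toℕ a))          ≡⟨ toℕ-shift fzero (toℕ a) (toℕ<n a) ⟩
  toℕ a                              ∎)
  where
  open ≡-Reasoning
  u = toℕ t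
  d = suc m ∸ u
  n+a∸u : (suc m + toℕ a) ∸ u ≡ d + toℕ a
  n+a∸u = trans (cong (λ z → (z + toℕ a) ∸ u) (sym (m+[n∸m]≡n (<⇒≤ (toℕ<n t)))))
           (trans (cong (_∸ u) (+-assoc u d (toℕ a))) (m+n∸m≡n u (d + toℕ a)))

shift-injective : (t : Fin (suc m)) {i j : ℕ} → i < suc m → j < suc m → shift t i ≡ shift t j → i ≡ j
shift-injective t {i} {j} i<n j<n eq = trans (sym (pos-shift t i i<n)) (trans (cong (pos t) eq) (pos-shift t j j<n))

prev≡shift : (t : Fin (suc m)) → prev t ≡ shift t m
prev≡shift {m} fzero = toℕ-injective (trans (toℕ-fromℕ m) (sym (toℕ-shift fzero m ≤-refl)))
prev≡shift {suc m} (fsuc i) = toℕ-injective (begin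
  toℕ (inject₁ i)                                        ≡⟨ toℕ-inject₁ i ⟩
  toℕ i                                                  ≡⟨ toℕ-shift fzero (toℕ i) (m<n⇒m<1+n (toℕ<n i)) ⟨
  toℕ (shift fzero (toℕ i))                              ≡⟨ cong toℕ (shift-past-wrap (fsuc i) (toℕ i)) ⟨
  toℕ (shift (fsuc i) ((suc (suc m) ∸ suc (toℕ i)) + toℕ i)) ≡⟨ cong (toℕ ∘ shift (fsuc i)) (m∸n+n≡m (<⇒≤ (toℕ<n i))) ⟩
  toℕ (shift (fsuc i) (suc m))                           ∎)
  where open ≡-Reasoning

next-prev : (t : Fin (suc m)) → next (prev t) ≡ t
next-prev {m} t = trans (cong next (prev≡shift t)) (trans (sym (shift-suc t m)) (shift-period t))

prev-next : (t : Fin (suc m)) → prev (next t) ≡ t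
prev-next {m} t = trans (prev≡shift (next t)) (shift-period t)

-- Finite subsets

x∈p─q⇒x∉q : ∀ {n} (p q : Subset n) {x : Fin n} → x ∈ p ─ q → x ∉ q
x∈p─q⇒x∉q (_ ∷ p) (inside  ∷ q) {fzero}  ()
x∈p─q⇒x∉q (_ ∷ p) (outside ∷ q) {fzero}  _          ()
x∈p─q⇒x∉q (_ ∷ p) (_       ∷ q) {fsuc x} (there h) (there h′) = x∈p─q⇒x∉q p q h h′

x∈p-y⁻ : ∀ {n} {p : Subset n} {x y : Fin n} → x ∈ p - y → x ∈ p × x ≢ y
x∈p-y⁻ {p = p} {x} {y} h = p─q⊆p p ⁅ y ⁆ h , λ { refl → x∈p─q⇒x∉q p ⁅ y ⁆ h (x∈⁅x⁆ y) }

x∈p∪⁅y⁆⁻ : ∀ {n} {p : Subset n} {x y : Fin n} → x ∈ p ∪ ⁅ y ⁆ → x ∈ p ⊎ x ≡ y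
x∈p∪⁅y⁆⁻ {p = p} {y = y} h with x∈p∪q⁻ p ⁅ y ⁆ h
... | inj₁ x∈p = inj₁ x∈p
... | inj₂ x∈y = inj₂ (x∈⁅y⁆⇒x≡y y x∈y)

x∈p⇒x∈p∪⁅y⁆ : ∀ {n} {p : Subset n} {x y : Fin n} → x ∈ p → x ∈ p ∪ ⁅ y ⁆
x∈p⇒x∈p∪⁅y⁆ h = x∈p∪q⁺ (inj₁ h)

y∈p∪⁅y⁆ : ∀ {n} {p : Subset n} (y : Fin n) → y ∈ p ∪ ⁅ y ⁆
y∈p∪⁅y⁆ y = x∈p∪q⁺ (inj₂ (x∈⁅x⁆ y))

∣p∪∅∣≡∣p∣ : ∀ {n} (p : Subset n) → ∣ p ∪ ∅ ∣ ≡ ∣ p ∣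
∣p∪∅∣≡∣p∣ p = cong ∣_∣ (∪-identityʳ p)

∣p∪⁅x⁆∣≡1+∣p∣ : ∀ {n} (p : Subset n) (x : Fin n) → x ∉ p → ∣ p ∪ ⁅ x ⁆ ∣ ≡ suc ∣ p ∣
∣p∪⁅x⁆∣≡1+∣p∣ (inside  ∷ p) fzero    x∉p = ⊥-elim (x∉p here)
∣p∪⁅x⁆∣≡1+∣p∣ (outside ∷ p) fzero    x∉p = cong suc (∣p∪∅∣≡∣p∣ p)
∣p∪⁅x⁆∣≡1+∣p∣ (inside  ∷ p) (fsuc x) x∉p = cong suc (∣p∪⁅x⁆∣≡1+∣p∣ p x (x∉p ∘ there))
∣p∪⁅x⁆∣≡1+∣p∣ (outside ∷ p) (fsuc x) x∉p = ∣p∪⁅x⁆∣≡1+∣p∣ p x (x∉p ∘ there)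

∣p∪⁅x⁆∣≤1+∣p∣ : ∀ {n} (p : Subset n) (x : Fin n) → ∣ p ∪ ⁅ x ⁆ ∣ ≤ suc ∣ p ∣
∣p∪⁅x⁆∣≤1+∣p∣ p x with x ∈? p
... | no  x∉p = ≤-reflexive (∣p∪⁅x⁆∣≡1+∣p∣ p x x∉p)
... | yes x∈p = m≤n⇒m≤1+n (≤-reflexive (cong ∣_∣ (⊆-antisym ⊆p (x∈p∪q⁺ ∘ inj₁))))
  where
  ⊆p : p ∪ ⁅ x ⁆ ⊆ p
  ⊆p h with x∈p∪⁅y⁆⁻ {p = p} h
  ... | inj₁ y∈p = y∈p
  ... | inj₂ refl = x∈p

p-x∪⁅x⁆≡p : ∀ {n} (p : Subset n) (x : Fin n) → x ∈ p → (p - x) ∪ ⁅ x ⁆ ≡ p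
p-x∪⁅x⁆≡p p x x∈p = ⊆-antisym ⊆p ⊇p
  where
  ⊆p : (p - x) ∪ ⁅ x ⁆ ⊆ p
  ⊆p h with x∈p∪⁅y⁆⁻ {p = p - x} h
  ... | inj₁ y∈p-x = proj₁ (x∈p-y⁻ y∈p-x)
  ... | inj₂ refl  = x∈p
  ⊇p : p ⊆ (p - x) ∪ ⁅ x ⁆
  ⊇p {y} y∈p with y ≟ᶠ x
  ... | yes refl = y∈p∪⁅y⁆ y
  ... | no  y≢x  = x∈p⇒x∈p∪⁅y⁆ (x∈p∧x≢y⇒x∈p-y y∈p y≢x)

p∪⁅x⁆-x≡p : ∀ {n} (p : Subset n) (x : Fin n) → x ∉ p → (p ∪ ⁅ x ⁆) - x ≡ p
p∪⁅x⁆-x≡p p x x∉p = ⊆-antisym ⊆p ⊇p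
  where
  ⊆p : (p ∪ ⁅ x ⁆) - x ⊆ p
  ⊆p h with x∈p-y⁻ h
  ... | h′ , y≢x with x∈p∪⁅y⁆⁻ {p = p} h′
  ... | inj₁ y∈p = y∈p
  ... | inj₂ y≡x = ⊥-elim (y≢x y≡x)
  ⊇p : p ⊆ (p ∪ ⁅ x ⁆) - x
  ⊇p y∈p = x∈p∧x≢y⇒x∈p-y (x∈p⇒x∈p∪⁅y⁆ y∈p) λ { refl → x∉p y∈p }

1+∣p-x∣≡∣p∣ : ∀ {n} (p : Subset n) (x : Fin n) → x ∈ p → suc ∣ p - x ∣ ≡ ∣ p ∣
1+∣p-x∣≡∣p∣ p x x∈p =
  trans (sym (∣p∪⁅x⁆∣≡1+∣p∣ (p - x) x (λ h → proj₂ (x∈p-y⁻ h) refl))) (cong ∣_∣ (p-x∪⁅x⁆≡p p x x∈p))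

∣p-x∣≡c : ∀ {n c} {p : Subset n} {x : Fin n} → x ∈ p → ∣ p ∣ ≡ suc c → ∣ p - x ∣ ≡ c
∣p-x∣≡c {p = p} {x} x∈p eq = suc-injective (trans (1+∣p-x∣≡∣p∣ p x x∈p) eq)

p-x≡q-y⇒∣p∣≡∣q∣ : ∀ {n} {p q : Subset n} {x y : Fin n} → x ∈ p → y ∈ q → p - x ≡ q - y → ∣ p ∣ ≡ ∣ q ∣
p-x≡q-y⇒∣p∣≡∣q∣ {p = p} {q} {x} {y} x∈p y∈q eq =
  trans (sym (1+∣p-x∣≡∣p∣ p x x∈p)) (trans (cong (suc ∘ ∣_∣) eq) (1+∣p-x∣≡∣p∣ q y y∈q))

∣p∣≡n∸c⇒∣∁p∣≡c : ∀ {n c} (p : Subset n) → c ≤ n → ∣ p ∣ ≡ n ∸ c → ∣ ∁ p ∣ ≡ c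
∣p∣≡n∸c⇒∣∁p∣≡c {n} p c≤n eq = trans (∣∁p∣≡n∸∣p∣ p) (trans (cong (n ∸_) eq) (m∸[m∸n]≡n c≤n))

∃∈ : ∀ {n} (p : Subset n) → 0 < ∣ p ∣ → ∃ λ x → x ∈ p
∃∈ {n} p 0<∣p∣ with nonempty? p
... | yes ne = ne
... | no ¬ne = ⊥-elim (<-irrefl (sym (trans (cong ∣_∣ (Empty-unique ¬ne)) (∣⊥∣≡0 n))) 0<∣p∣)

∃∉ : ∀ {n} (p : Subset n) → ∣ p ∣ < n → ∃ λ x → x ∉ p
∃∉ {n} p ∣p∣<n with any? (λ x → ¬? (x ∈? p))
... | yes ∃x∉p = ∃x∉p
... | no ¬∃x∉p = ⊥-elim (<⇒≱ ∣p∣<n (subst (_≤ ∣ p ∣) (∣⊤∣≡n n) (p⊆q⇒∣p∣≤∣q∣ ⊤⊆p)))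
  where
  ⊤⊆p : ⊤ ⊆ p
  ⊤⊆p {x} _ with x ∈? p
  ... | yes x∈p = x∈p
  ... | no  x∉p = ⊥-elim (¬∃x∉p (x , x∉p))

⊆∧∣q∣≤∣p∣⇒≡ : ∀ {n} {p q : Subset n} → p ⊆ q → ∣ q ∣ ≤ ∣ p ∣ → p ≡ q
⊆∧∣q∣≤∣p∣⇒≡ {p = p} {q} p⊆q ∣q∣≤∣p∣ with any? (λ x → (x ∈? q) ×-dec ¬? (x ∈? p))
... | yes (x , x∈q , x∉p) = ⊥-elim (<⇒≱ (p⊂q⇒∣p∣<∣q∣ (p⊆q , x , x∈q , x∉p)) ∣q∣≤∣p∣)
... | no  ¬∃ = ⊆-antisym p⊆q q⊆p
  where
  q⊆p : q ⊆ p
  q⊆p {x} x∈q with x ∈? p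
  ... | yes x∈p = x∈p
  ... | no  x∉p = ⊥-elim (¬∃ (x , x∈q , x∉p))

⊆-extend : ∀ {n} (X : Subset n) k → ∣ X ∣ ≤ k → k ≤ n → ∃ λ Z → X ⊆ Z × ∣ Z ∣ ≡ k
⊆-extend X zero    ∣X∣≤0 _ = X , (λ h → h) , n≤0⇒n≡0 ∣X∣≤0
⊆-extend {n} X (suc k) ∣X∣≤k k<n with ∣ X ∣ ≟ suc k
... | yes ∣X∣≡k = X , (λ h → h) , ∣X∣≡k
... | no  ∣X∣≢k with ⊆-extend X k (s≤s⁻¹ (≤∧≢⇒< ∣X∣≤k ∣X∣≢k)) (<⇒≤ k<n)
... | Z , X⊆Z , ∣Z∣≡k with ∃∉ Z (subst (_< n) (sym ∣Z∣≡k) k<n)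
... | z , z∉Z = Z ∪ ⁅ z ⁆ , x∈p⇒x∈p∪⁅y⁆ ∘ X⊆Z , trans (∣p∪⁅x⁆∣≡1+∣p∣ Z z z∉Z) (cong suc ∣Z∣≡k)

∁-involutive : ∀ {n} (p : Subset n) → ∁ (∁ p) ≡ p
∁-involutive p = ⊆-antisym (x∉∁p⇒x∈p ∘ x∈∁p⇒x∉p) (x∉p⇒x∈∁p ∘ x∈p⇒x∉∁p)

-- Cyclic intervals

∈cycInterval⁻ : ∀ {n} k (t a : Fin n) → a ∈ cycInterval k t → ∃ λ j → j < k × a ≡ shift t j
∈cycInterval⁻ zero    t a h = ⊥-elim (∉⊥ h)
∈cycInterval⁻ (suc k) t a h with x∈p∪q⁻ ⁅ t ⁆ (cycInterval k (next t)) h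
... | inj₁ a∈t = 0 , s≤s z≤n , x∈⁅y⁆⇒x≡y t a∈t
... | inj₂ h′ with ∈cycInterval⁻ k (next t) a h′
... | j , j<k , a≡ = suc j , s≤s j<k , a≡

shift∈cycInterval : ∀ {n} k (t : Fin n) j → j < k → shift t j ∈ cycInterval k t
shift∈cycInterval (suc k) t zero    _         = x∈p∪q⁺ (inj₁ (x∈⁅x⁆ t))
shift∈cycInterval (suc k) t (suc j) (s≤s j<k) = x∈p∪q⁺ (inj₂ (shift∈cycInterval k (next t) j j<k))

shift∈cycInterval⁻ : ∀ k (t : Fin (suc m)) j → k ≤ suc m → j < suc m → shift t j ∈ cycInterval k t → j < k
shift∈cycInterval⁻ k t j k≤n j<n h with ∈cycInterval⁻ k t (shift t j) h
... | i , i<k , eq = subst (_< k) (shift-injective t (<-≤-trans i<k k≤n) j<n (sym eq)) i<k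

∈cycInterval⇒pos< : ∀ k (t a : Fin (suc m)) → k ≤ suc m → a ∈ cycInterval k t → pos t a < k
∈cycInterval⇒pos< k t a k≤n h =
  shift∈cycInterval⁻ k t (pos t a) k≤n (pos<n t a) (subst (_∈ cycInterval k t) (sym (shift-pos t a)) h)

pos<⇒∈cycInterval : ∀ k (t a : Fin (suc m)) → pos t a < k → a ∈ cycInterval k t
pos<⇒∈cycInterval k t a lt = subst (_∈ cycInterval k t) (shift-pos t a) (shift∈cycInterval k t (pos t a) lt)

cycInterval-⊆-suc : ∀ {n} k (t : Fin n) → cycInterval k t ⊆ cycInterval (suc k) t
cycInterval-⊆-suc k t {a} h with ∈cycInterval⁻ k t a h
... | j , j<k , refl = shift∈cycInterval (suc k) t j (m<n⇒m<1+n j<k)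

∈cycInterval-suc⁻ : ∀ {n} k (t a : Fin n) → a ∈ cycInterval (suc k) t → a ∈ cycInterval k t ⊎ a ≡ shift t k
∈cycInterval-suc⁻ k t a h with ∈cycInterval⁻ (suc k) t a h
... | j , s≤s j≤k , refl with m≤n⇒m<n∨m≡n j≤k
...   | inj₁ j<k  = inj₁ (shift∈cycInterval k t j j<k)
...   | inj₂ refl = inj₂ refl

∣cycInterval∣ : ∀ k (t : Fin (suc m)) → k ≤ suc m → ∣ cycInterval k t ∣ ≡ k
∣cycInterval∣ {m} zero    t _   = ∣⊥∣≡0 (suc m)
∣cycInterval∣     (suc k) t k<n = begin
  ∣ ⁅ t ⁆ ∪ cycInterval k (next t) ∣  ≡⟨ cong ∣_∣ (∪-comm ⁅ t ⁆ (cycInterval k (next t))) ⟩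
  ∣ cycInterval k (next t) ∪ ⁅ t ⁆ ∣  ≡⟨ ∣p∪⁅x⁆∣≡1+∣p∣ (cycInterval k (next t)) t t∉ ⟩
  suc ∣ cycInterval k (next t) ∣      ≡⟨ cong suc (∣cycInterval∣ k (next t) (<⇒≤ k<n)) ⟩
  suc k                               ∎
  where
  open ≡-Reasoning
  t∉ : t ∉ cycInterval k (next t)
  t∉ h with ∈cycInterval⁻ k (next t) t h
  ... | j , j<k , eq = 1+n≢0 (sym (shift-injective t (s≤s z≤n) (s≤s (<-≤-trans j<k (s≤s⁻¹ k<n))) eq))

-- Lists of natural numbers

range : ℕ → ℕ → List ℕ
range a zero    = []
range a (suc c) = a ∷ range (suc a) c

applyUpTo-+ : ∀ (f : ℕ → ℕ) a c → (∀ j → f j ≡ a + j) → applyUpTo f c ≡ range a c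
applyUpTo-+ f a zero    _  = refl
applyUpTo-+ f a (suc c) eq = cong₂ _∷_ (trans (eq 0) (+-identityʳ a))
  (applyUpTo-+ (f ∘ suc) (suc a) c (λ j → trans (eq (suc j)) (+-suc a j)))

upTo≡range : ∀ n → upTo n ≡ range 0 n
upTo≡range n = applyUpTo-+ (λ j → j) 0 n (λ _ → refl)

range-+ : ∀ a b c → range a (b + c) ≡ range a b ++ range (a + b) c
range-+ a zero    c = cong (λ z → range z c) (sym (+-identityʳ a))
range-+ a (suc b) c = cong (a ∷_) (trans (range-+ (suc a) b c) (cong (λ z → range (suc a) b ++ range z c) (sym (+-suc a b))))

length-range : ∀ a c → length (range a c) ≡ c
length-range a zero    = refl
length-range a (suc c) = cong suc (length-range (suc a) c)

InRange : ℕ → ℕ → ℕ → Set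
InRange a c j = a ≤ j × j < a + c

InRange-here : ∀ a c → InRange a (suc c) a
InRange-here a c = ≤-refl , subst (a <_) (sym (+-suc a c)) (s≤s (m≤m+n a c))

InRange-widen : ∀ {a c j} → InRange (suc a) c j → InRange a (suc c) j
InRange-widen {a} {c} {j} (a<j , j<) = <⇒≤ a<j , subst (j <_) (sym (+-suc a c)) j<

InRange-narrow : ∀ {a c j} → InRange a (suc c) j → j ≢ a → InRange (suc a) c j
InRange-narrow {a} {c} {j} (a≤j , j<) j≢a = ≤∧≢⇒< a≤j (j≢a ∘ sym) , subst (j <_) (+-suc a c) j<

All-InRange : ∀ a c → All (InRange a c) (range a c)
All-InRange a zero    = []
All-InRange a (suc c) = InRange-here a c ∷ All.map InRange-widen (All-InRange (suc a) c)

filter-map : ∀ {A B : Set} {P : Pred B 0ℓ} (P? : Decidable P) (f : A → B) xs →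
             filter P? (map f xs) ≡ map f (filter (P? ∘ f) xs)
filter-map P? f []       = refl
filter-map P? f (x ∷ xs) with does (P? (f x))
... | true  = cong (f x ∷_) (filter-map P? f xs)
... | false = filter-map P? f xs

filter-congᴬ : ∀ {P Q : Pred ℕ 0ℓ} (P? : Decidable P) (Q? : Decidable Q) {xs} →
               All (λ j → P j → Q j) xs → All (λ j → Q j → P j) xs → filter P? xs ≡ filter Q? xs
filter-congᴬ P? Q? [] [] = refl
filter-congᴬ P? Q? {j ∷ _} (P⇒Q ∷ P⇒Qs) (Q⇒P ∷ Q⇒Ps) with P? j | Q? j
... | yes _  | yes _  = cong (j ∷_) (filter-congᴬ P? Q? P⇒Qs Q⇒Ps)
... | no  _  | no  _  = filter-congᴬ P? Q? P⇒Qs Q⇒Ps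
... | yes Pj | no ¬Qj = ⊥-elim (¬Qj (P⇒Q Pj))
... | no ¬Pj | yes Qj = ⊥-elim (¬Pj (Q⇒P Qj))

length-filter-insert : ∀ {P Q : Pred ℕ 0ℓ} (P? : Decidable P) (Q? : Decidable Q) a c {j₀} → InRange a c j₀ →
  (∀ {j} → InRange a c j → Q j → j ≢ j₀ → P j) → (∀ {j} → P j → Q j) → Q j₀ → ¬ P j₀ →
  length (filter Q? (range a c)) ≡ suc (length (filter P? (range a c)))
length-filter-insert P? Q? a zero (a≤j₀ , j₀<a+0) _ _ _ _ = ⊥-elim (<⇒≱ j₀<a+0 (subst (_≤ _) (sym (+-identityʳ a)) a≤j₀))
length-filter-insert {P} {Q} P? Q? a (suc c) {j₀} r Q⇒P P⇒Q Qj₀ ¬Pj₀ with j₀ ≟ a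
... | yes refl = begin
  length (filter Q? (a ∷ tail))        ≡⟨ cong length (filter-accept Q? Qj₀) ⟩
  suc (length (filter Q? tail))        ≡⟨ cong (suc ∘ length) (filter-congᴬ Q? P? (All.map Q⇒P′ inTail) (All.map (λ _ → P⇒Q) inTail)) ⟩
  suc (length (filter P? tail))        ≡⟨ cong (suc ∘ length) (filter-reject P? ¬Pj₀) ⟨
  suc (length (filter P? (a ∷ tail)))  ∎
  where
  open ≡-Reasoning
  tail = range (suc a) c
  inTail = All-InRange (suc a) c
  Q⇒P′ : ∀ {j} → InRange (suc a) c j → Q j → P j
  Q⇒P′ r@(a<j , _) Qj = Q⇒P (InRange-widen r) Qj (λ { refl → <-irrefl refl a<j })
... | no j₀≢a with Q? a | P? a | length-filter-insert P? Q? (suc a) c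
      (InRange-narrow r j₀≢a) (Q⇒P ∘ InRange-widen) P⇒Q Qj₀ ¬Pj₀
... | yes _  | yes _  | IH = cong suc IH
... | no  _  | no  _  | IH = IH
... | yes Qa | no ¬Pa | _  = ⊥-elim (¬Pa (Q⇒P (InRange-here a c) Qa (j₀≢a ∘ sym)))
... | no ¬Qa | yes Pa | _  = ⊥-elim (¬Qa (P⇒Q Pa))

countBelow : ℕ → List ℕ → ℕ
countBelow c xs = length (filter (_<? c) xs)

countBelow-antitone : ∀ c {xs ys} → Pointwise _≤_ xs ys → countBelow c ys ≤ countBelow c xs
countBelow-antitone c [] = z≤n
countBelow-antitone c {x ∷ _} {y ∷ _} (x≤y ∷ rs) with y <? c | x <? c
... | yes y<c | yes x<c = subst₂ _≤_ (sym (cong length (filter-accept (_<? c) y<c)))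
                            (sym (cong length (filter-accept (_<? c) x<c))) (s≤s (countBelow-antitone c rs))
... | yes y<c | no  x≮c = ⊥-elim (x≮c (≤-<-trans x≤y y<c))
... | no  y≮c | yes x<c = subst₂ _≤_ (sym (cong length (filter-reject (_<? c) y≮c)))
                            (sym (cong length (filter-accept (_<? c) x<c))) (m≤n⇒m≤1+n (countBelow-antitone c rs))
... | no  y≮c | no  x≮c = subst₂ _≤_ (sym (cong length (filter-reject (_<? c) y≮c)))
                            (sym (cong length (filter-reject (_<? c) x≮c))) (countBelow-antitone c rs)

countBelow-filter-range : ∀ {P : Pred ℕ 0ℓ} (P? : Decidable P) c n → c ≤ n →
  countBelow c (filter P? (range 0 n)) ≡ length (filter P? (range 0 c))
countBelow-filter-range P? c n c≤n = begin
  length (filter (_<? c) (filter P? (range 0 n)))                                    ≡⟨ cong (λ xs → length (filter (_<? c) (filter P? xs))) split ⟩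
  length (filter (_<? c) (filter P? (range 0 c ++ range c (n ∸ c))))                 ≡⟨ cong (length ∘ filter (_<? c)) (filter-++ P? (range 0 c) _) ⟩
  length (filter (_<? c) (filter P? (range 0 c) ++ filter P? (range c (n ∸ c))))     ≡⟨ cong length (filter-++ (_<? c) (filter P? (range 0 c)) _) ⟩
  length (filter (_<? c) (filter P? (range 0 c)) ++ filter (_<? c) (filter P? (range c (n ∸ c))))
    ≡⟨ cong₂ (λ xs ys → length (xs ++ ys))
         (filter-all (_<? c) (filter⁺ P? (All.map proj₂ (All-InRange 0 c))))
         (filter-none (_<? c) (filter⁺ P? (All.map (≤⇒≯ ∘ proj₁) (All-InRange c (n ∸ c))))) ⟩
  length (filter P? (range 0 c) ++ [])                                               ≡⟨ cong length (++-identityʳ (filter P? (range 0 c))) ⟩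
  length (filter P? (range 0 c))                                                     ∎
  where
  open ≡-Reasoning
  split = trans (cong (range 0) (sym (m+[n∸m]≡n c≤n))) (range-+ 0 c (n ∸ c))

data Ascending : ℕ → List ℕ → Set where
  []  : ∀ {a} → Ascending a []
  _∷_ : ∀ {a y ys} → a ≤ y → Ascending (suc y) ys → Ascending a (y ∷ ys)

Ascending-weaken : ∀ {a b ys} → b ≤ a → Ascending a ys → Ascending b ys
Ascending-weaken b≤a []         = []
Ascending-weaken b≤a (a≤y ∷ ys) = ≤-trans b≤a a≤y ∷ ys

filter-range-ascending : ∀ {P : Pred ℕ 0ℓ} (P? : Decidable P) a c → Ascending a (filter P? (range a c))
filter-range-ascending P? a zero    = []
filter-range-ascending P? a (suc c) with does (P? a)
... | true  = ≤-refl ∷ filter-range-ascending P? (suc a) c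
... | false = Ascending-weaken (n≤1+n a) (filter-range-ascending P? (suc a) c)

range≤ascending : ∀ {a ys} → Ascending a ys → Pointwise _≤_ (range a (length ys)) ys
range≤ascending []         = []
range≤ascending (a≤y ∷ ys) = a≤y ∷ range≤ascending (Ascending-weaken (s≤s a≤y) ys)

Pointwise-≤-trans : ∀ {xs ys zs} → Pointwise _≤_ xs ys → Pointwise _≤_ ys zs → Pointwise _≤_ xs zs
Pointwise-≤-trans []         []         = []
Pointwise-≤-trans (r ∷ rs) (s ∷ ss) = ≤-trans r s ∷ Pointwise-≤-trans rs ss

bumpedRange : ℕ → ℕ → List ℕ
bumpedRange a c = range a c ++ [ a + suc c ]

bumpedRange≤range : ∀ a c → Pointwise _≤_ (bumpedRange a c) (range (suc a) (suc c))
bumpedRange≤range a zero    = ≤-reflexive (+-comm a 1) ∷ []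
bumpedRange≤range a (suc c) = n≤1+n a ∷
  subst (λ z → Pointwise _≤_ (range (suc a) c ++ [ z ]) (range (suc (suc a)) (suc c))) (sym (+-suc a (suc c)))
    (bumpedRange≤range (suc a) c)

bumpedRange≰range : ∀ a c → ¬ Pointwise _≤_ (bumpedRange a c) (range a (suc c))
bumpedRange≰range a zero    (r ∷ [])     = <-irrefl refl (subst (_≤ a) (+-comm a 1) r)
bumpedRange≰range a (suc c) (_ ∷ rs) = bumpedRange≰range (suc a) c
  (subst (λ z → Pointwise _≤_ (range (suc a) c ++ [ z ]) (range (suc a) (suc c))) (+-suc a (suc c)) rs)

ascending-range⊎bumpedRange≤ : ∀ c a ys → Ascending a ys → length ys ≡ suc c →
  ys ≡ range a (suc c) ⊎ Pointwise _≤_ (bumpedRange a c) ys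
ascending-range⊎bumpedRange≤ c a (y ∷ ys) (a≤y ∷ asc) len with y ≟ a
ascending-range⊎bumpedRange≤ zero    a (y ∷ []) (_ ∷ _) _ | yes refl = inj₁ refl
ascending-range⊎bumpedRange≤ (suc c) a (y ∷ ys) (_ ∷ asc) len | yes refl
  with ascending-range⊎bumpedRange≤ c (suc a) ys asc (suc-injective len)
... | inj₁ eq = inj₁ (cong (a ∷_) eq)
... | inj₂ rs = inj₂ (≤-refl ∷ subst (λ z → Pointwise _≤_ (range (suc a) c ++ [ z ]) ys) (sym (+-suc a (suc c))) rs)
ascending-range⊎bumpedRange≤ c a (y ∷ ys) (a≤y ∷ asc) len | no y≢a =
  inj₂ (Pointwise-≤-trans (bumpedRange≤range a c)
    (subst (λ z → Pointwise _≤_ (range (suc a) z) (y ∷ ys)) len (range≤ascending (≤∧≢⇒< a≤y (y≢a ∘ sym) ∷ asc))))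

Pointwise-≤-All-< : ∀ {c xs ys} → Pointwise _≤_ xs ys → All (_< c) ys → All (_< c) xs
Pointwise-≤-All-< []       []           = []
Pointwise-≤-All-< (r ∷ rs) (y<c ∷ ys<c) = ≤-<-trans r y<c ∷ Pointwise-≤-All-< rs ys<c

Any-range : ∀ {P : Pred ℕ 0ℓ} a c {j} → InRange a c j → P j → Any P (range a c)
Any-range a zero    (a≤j , j<a+0) _  = ⊥-elim (<⇒≱ j<a+0 (subst (_≤ _) (sym (+-identityʳ a)) a≤j))
Any-range a (suc c) {j} r Pj with j ≟ a
... | yes refl = here Pj
... | no  j≢a  = there (Any-range (suc a) c (InRange-narrow r j≢a) Pj)

Pointwise-map-bounded : ∀ {R S : ℕ → ℕ → Set} {c xs ys} → (∀ {x y} → x < c → y < c → R x y → S x y) →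
  All (_< c) xs → All (_< c) ys → Pointwise R xs ys → Pointwise S xs ys
Pointwise-map-bounded f []         []         []       = []
Pointwise-map-bounded f (x<c ∷ xs) (y<c ∷ ys) (r ∷ rs) = f x<c y<c r ∷ Pointwise-map-bounded f xs ys rs

-- Offsets and the Gale order

positions : Fin (suc m) → Subset (suc m) → List ℕ
positions {m} t X = filter (λ j → shift t j ∈? X) (range 0 (suc m))

positions-bounded : (t : Fin (suc m)) (X : Subset (suc m)) → All (_< suc m) (positions t X)
positions-bounded {m} t X = filter⁺ (λ j → shift t j ∈? X) (All.map proj₂ (All-InRange 0 (suc m)))

pos∈positions : (t : Fin (suc m)) {X : Subset (suc m)} {x : Fin (suc m)} → x ∈ X → Any (pos t x ≡_) (positions t X)
pos∈positions {m} t {X} {x} x∈X = ∈-filter⁺ (λ j → shift t j ∈? X) (Any-range 0 (suc m) (z≤n , pos<n t x) refl)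
  (subst (_∈ X) (sym (shift-pos t x)) x∈X)

sortedBy≡map-shift-positions : (t : Fin (suc m)) (X : Subset (suc m)) → sortedBy t X ≡ map (shift t) (positions t X)
sortedBy≡map-shift-positions {m} t X =
  trans (cong (filter (_∈? X) ∘ map (shift t)) (upTo≡range (suc m))) (filter-map (_∈? X) (shift t) (range 0 (suc m)))

GaleLe⇒positions≤ : (t : Fin (suc m)) (I J : Subset (suc m)) → GaleLe t I J → Pointwise _≤_ (positions t I) (positions t J)
GaleLe⇒positions≤ t I J I≤J = Pointwise-map-bounded (λ i<n j<n → subst₂ _≤_ (pos-shift t _ i<n) (pos-shift t _ j<n))
  (positions-bounded t I) (positions-bounded t J)
  (map⁻ (shift t) (shift t) (subst₂ (Pointwise (λ a b → a ≤[ t ] b)) (sortedBy≡map-shift-positions t I) (sortedBy≡map-shift-positions t J) I≤J))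

positions≤⇒GaleLe : (t : Fin (suc m)) (I J : Subset (suc m)) → Pointwise _≤_ (positions t I) (positions t J) → GaleLe t I J
positions≤⇒GaleLe t I J I≤J =
  subst₂ (Pointwise (λ a b → a ≤[ t ] b)) (sym (sortedBy≡map-shift-positions t I)) (sym (sortedBy≡map-shift-positions t J))
    (map⁺ (shift t) (shift t) (Pointwise-map-bounded (λ i<n j<n → subst₂ _≤_ (sym (pos-shift t _ i<n)) (sym (pos-shift t _ j<n)))
      (positions-bounded t I) (positions-bounded t J) I≤J))

length-positions : (t : Fin (suc m)) (X : Subset (suc m)) → length (positions t X) ≡ ∣ X ∣
length-positions {m} t X = go ∣ X ∣ X refl
  where
  go : ∀ c X → ∣ X ∣ ≡ c → length (positions t X) ≡ c
  go zero    X ∣X∣≡0 = cong length (filter-none (λ j → shift t j ∈? X) {xs = range 0 (suc m)} (All.tabulate λ {j} _ h → 1+n≢0 (trans (1+∣p-x∣≡∣p∣ X _ h) ∣X∣≡0)))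
  go (suc c) X ∣X∣≡c with ∃∈ X (subst (0 <_) (sym ∣X∣≡c) (s≤s z≤n))
  ... | x , x∈X = trans
    (length-filter-insert (λ j → shift t j ∈? X - x) (λ j → shift t j ∈? X) 0 _ (z≤n , pos<n t x) Q⇒P
      (λ h → proj₁ (x∈p-y⁻ h)) (subst (_∈ X) (sym (shift-pos t x)) x∈X) (λ h → proj₂ (x∈p-y⁻ h) (shift-pos t x)))
    (cong suc (go c (X - x) (∣p-x∣≡c x∈X ∣X∣≡c)))
    where
    Q⇒P : ∀ {j} → InRange 0 _ j → shift t j ∈ X → j ≢ pos t x → shift t j ∈ X - x
    Q⇒P {j} (_ , j<n) h j≢ = x∈p∧x≢y⇒x∈p-y h λ eq → j≢ (trans (sym (pos-shift t j j<n)) (cong (pos t) eq))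

positions-cycInterval : ∀ k (t : Fin (suc m)) → k ≤ suc m → positions t (cycInterval k t) ≡ range 0 k
positions-cycInterval {m} k t k≤n = begin
  filter P? (range 0 (suc m))                        ≡⟨ cong (filter P?) split ⟩
  filter P? (range 0 k ++ range k (suc m ∸ k))       ≡⟨ filter-++ P? (range 0 k) _ ⟩
  filter P? (range 0 k) ++ filter P? (range k (suc m ∸ k))
    ≡⟨ cong₂ _++_ (filter-all P? (All.map (shift∈cycInterval k t _ ∘ proj₂) (All-InRange 0 k)))
                  (filter-none P? (All.map beyond (All-InRange k (suc m ∸ k)))) ⟩
  range 0 k ++ []                                    ≡⟨ ++-identityʳ (range 0 k) ⟩
  range 0 k                                          ∎
  where
  open ≡-Reasoning
  P? = λ j → shift t j ∈? cycInterval k t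
  split = trans (cong (range 0) (sym (m+[n∸m]≡n k≤n))) (range-+ 0 k (suc m ∸ k))
  beyond : ∀ {j} → InRange k (suc m ∸ k) j → shift t j ∉ cycInterval k t
  beyond {j} (k≤j , j<) h = <⇒≱ (shift∈cycInterval⁻ k t j k≤n (subst (j <_) (m+[n∸m]≡n k≤n) j<) h) k≤j

bumpedInterval : ∀ {n} → ℕ → Fin n → Subset n
bumpedInterval k t = (cycInterval k t - shift t (k ∸ 1)) ∪ ⁅ shift t k ⁆

module _ {m : ℕ} (k : ℕ) (t : Fin (suc m)) (k<n : suc k < suc m) where

  private
    k≤n : k ≤ suc m
    k≤n = ≤-trans (n≤1+n k) (<⇒≤ k<n)

  cycInterval⊆bumpedInterval : cycInterval k t ⊆ bumpedInterval (suc k) t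
  cycInterval⊆bumpedInterval h = x∈p⇒x∈p∪⁅y⁆ (x∈p∧x≢y⇒x∈p-y (cycInterval-⊆-suc k t h)
    λ { refl → <-irrefl refl (shift∈cycInterval⁻ k t k k≤n (<⇒≤ k<n) h) })

  ∈bumpedInterval⁻ : ∀ {x} → x ∈ bumpedInterval (suc k) t → x ∈ cycInterval k t ⊎ x ≡ shift t (suc k)
  ∈bumpedInterval⁻ {x} h with x∈p∪⁅y⁆⁻ {p = cycInterval (suc k) t - shift t k} h
  ... | inj₂ x≡ = inj₂ x≡
  ... | inj₁ h′ with x∈p-y⁻ h′
  ... | x∈C , x≢ with ∈cycInterval-suc⁻ k t x x∈C
  ...   | inj₁ x∈C′ = inj₁ x∈C′
  ...   | inj₂ x≡   = ⊥-elim (x≢ x≡)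

  shift∉bumpedInterval : shift t k ∉ bumpedInterval (suc k) t
  shift∉bumpedInterval h with ∈bumpedInterval⁻ h
  ... | inj₁ h′ = <-irrefl refl (shift∈cycInterval⁻ k t k k≤n (<⇒≤ k<n) h′)
  ... | inj₂ eq = <-irrefl (shift-injective t (<⇒≤ k<n) k<n eq) (n<1+n k)

  positions-bumpedInterval : positions t (bumpedInterval (suc k) t) ≡ bumpedRange 0 k
  positions-bumpedInterval = begin
    filter P? (range 0 (suc m))                                     ≡⟨ cong (filter P?) split ⟩
    filter P? (range 0 k ++ k ∷ suc k ∷ range (suc (suc k)) r)      ≡⟨ filter-++ P? (range 0 k) _ ⟩
    filter P? (range 0 k) ++ filter P? (k ∷ suc k ∷ range (suc (suc k)) r)
      ≡⟨ cong₂ _++_ (filter-all P? (All.map (cycInterval⊆bumpedInterval ∘ shift∈cycInterval k t _ ∘ proj₂) (All-InRange 0 k)))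
                    (trans (filter-reject P? {k} shift∉bumpedInterval) (filter-accept P? {suc k} (y∈p∪⁅y⁆ _))) ⟩
    range 0 k ++ suc k ∷ filter P? (range (suc (suc k)) r)          ≡⟨ cong (λ xs → range 0 k ++ suc k ∷ xs) (filter-none P? (All.map beyond (All-InRange _ r))) ⟩
    bumpedRange 0 k                                                 ∎
    where
    open ≡-Reasoning
    P? = λ j → shift t j ∈? bumpedInterval (suc k) t
    r = suc m ∸ suc (suc k)
    len : k + (2 + r) ≡ suc m
    len = trans (+-suc k (suc r)) (trans (cong suc (+-suc k r)) (m+[n∸m]≡n k<n))
    split = trans (cong (range 0) (sym len)) (range-+ 0 k (2 + r))
    beyond : ∀ {j} → InRange (suc (suc k)) r j → shift t j ∉ bumpedInterval (suc k) t
    beyond {j} (k+1<j , j<) h with ∈bumpedInterval⁻ h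
    ... | inj₁ h′ = <⇒≱ (shift∈cycInterval⁻ k t j k≤n j<n h′) (≤-trans (n≤1+n k) (<⇒≤ k+1<j))
      where j<n = subst (j <_) (trans (sym (trans (+-suc k (suc r)) (cong suc (+-suc k r)))) len) j<
    ... | inj₂ eq = <-irrefl (shift-injective t k<n j<n (sym eq)) k+1<j
      where j<n = subst (j <_) (trans (sym (trans (+-suc k (suc r)) (cong suc (+-suc k r)))) len) j<

cycInterval-GaleLe : ∀ k (t : Fin (suc m)) (J : Subset (suc m)) → k ≤ suc m → ∣ J ∣ ≡ k → GaleLe t (cycInterval k t) J
cycInterval-GaleLe {m} k t J k≤n ∣J∣≡k = positions≤⇒GaleLe t _ J
  (subst (λ xs → Pointwise _≤_ xs (positions t J))
    (trans (cong (range 0) (trans (length-positions t J) ∣J∣≡k)) (sym (positions-cycInterval k t k≤n)))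
    (range≤ascending (filter-range-ascending (λ j → shift t j ∈? J) 0 (suc m))))

bumpedInterval-¬GaleLe-cycInterval : ∀ k (t : Fin (suc m)) → suc k < suc m →
  ¬ GaleLe t (bumpedInterval (suc k) t) (cycInterval (suc k) t)
bumpedInterval-¬GaleLe-cycInterval k t k<n ≤C = bumpedRange≰range 0 k
  (subst₂ (Pointwise _≤_) (positions-bumpedInterval k t k<n) (positions-cycInterval (suc k) t (<⇒≤ k<n))
    (GaleLe⇒positions≤ t _ _ ≤C))

bumpedInterval-GaleLe : ∀ k (t : Fin (suc m)) (J : Subset (suc m)) → suc k < suc m → ∣ J ∣ ≡ suc k →
  J ≢ cycInterval (suc k) t → GaleLe t (bumpedInterval (suc k) t) J
bumpedInterval-GaleLe {m} k t J k<n ∣J∣≡k J≢C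
  with ascending-range⊎bumpedRange≤ k 0 (positions t J) (filter-range-ascending (λ j → shift t j ∈? J) 0 (suc m))
         (trans (length-positions t J) ∣J∣≡k)
... | inj₂ ≤J = positions≤⇒GaleLe t _ J (subst (λ xs → Pointwise _≤_ xs (positions t J)) (sym (positions-bumpedInterval k t k<n)) ≤J)
... | inj₁ eq = ⊥-elim (J≢C (sym (⊆∧∣q∣≤∣p∣⇒≡ C⊆J (≤-reflexive (trans ∣J∣≡k (sym (∣cycInterval∣ (suc k) t (<⇒≤ k<n))))))))
  where
  C⊆J : cycInterval (suc k) t ⊆ J
  C⊆J {x} h = subst (_∈ J) (shift-pos t x) (proj₂ (∈-filter⁻ (λ j → shift t j ∈? J) {xs = range 0 (suc m)}
    (subst (Any (pos t x ≡_)) (sym eq) (Any-range 0 (suc k) (z≤n , ∈cycInterval⇒pos< (suc k) t x (<⇒≤ k<n) h) refl))))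

GaleLe-prefix : ∀ c (t : Fin (suc m)) (I J : Subset (suc m)) → c ≤ suc m → GaleLe t I J →
  cycInterval c t ⊆ J → cycInterval c t ⊆ I
GaleLe-prefix {m} c t I J c≤n I≤J C⊆J {x} x∈C with x ∈? I
... | yes x∈I = x∈I
... | no  x∉I = ⊥-elim (<⇒≱ countI<c (begin
  c                                     ≡⟨ countJ ⟨
  countBelow c (positions t J)          ≤⟨ countBelow-antitone c (GaleLe⇒positions≤ t I J I≤J) ⟩
  countBelow c (positions t I)          ≡⟨ countBelow-filter-range P? c (suc m) c≤n ⟩
  length (filter P? (range 0 c))        ∎))
  where
  open ≤-Reasoning
  P? = λ j → shift t j ∈? I
  countI<c : length (filter P? (range 0 c)) < c
  countI<c = subst (length (filter P? (range 0 c)) <_) (length-range 0 c) (filter-notAll P? (range 0 c)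
    (Any-range 0 c (z≤n , ∈cycInterval⇒pos< c t x c≤n x∈C) (λ h → x∉I (subst (_∈ I) (shift-pos t x) h))))
  countJ : countBelow c (positions t J) ≡ c
  countJ = trans (countBelow-filter-range (λ j → shift t j ∈? J) c (suc m) c≤n)
    (trans (cong length (filter-all (λ j → shift t j ∈? J) (All.map (C⊆J ∘ shift∈cycInterval c t _ ∘ proj₂) (All-InRange 0 c))))
      (length-range 0 c))

GaleLe-suffix : ∀ c (t : Fin (suc m)) (I J : Subset (suc m)) → c ≤ suc m → GaleLe t I J →
  J ⊆ cycInterval c t → I ⊆ cycInterval c t
GaleLe-suffix {m} c t I J c≤n I≤J J⊆C {x} x∈I = pos<⇒∈cycInterval c t x
  (All.lookup (Pointwise-≤-All-< (GaleLe⇒positions≤ t I J I≤J) J<c) (pos∈positions t x∈I))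
  where
  J<c : All (_< c) (positions t J)
  J<c = All.zipWith (λ { (j<n , h) → shift∈cycInterval⁻ c t _ c≤n j<n (J⊆C h) })
    (positions-bounded t J , all-filter (λ j → shift t j ∈? J) (range 0 (suc m)))

-- Intervals differing in one element

next≢ : (t : Fin (suc m)) → 1 < suc m → next t ≢ t
next≢ t 1<n eq = 1+n≢0 (shift-injective t 1<n (s≤s z≤n) eq)

prev∈cycInterval : ∀ k (t x : Fin (suc m)) → x ∈ cycInterval k t → x ≢ t → prev x ∈ cycInterval k t
prev∈cycInterval k t x h x≢t with ∈cycInterval⁻ k t x h
... | zero  , _   , x≡t = ⊥-elim (x≢t x≡t)
... | suc j , j<k , refl = subst (_∈ cycInterval k t) (sym (trans (cong prev (shift-suc t j)) (prev-next (shift t j))))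
                            (shift∈cycInterval k t j (<⇒≤ j<k))

cycIntervals-cover : ∀ k (t t′ y : Fin (suc m)) → k ≤ suc m → t ∈ cycInterval k t′ → t′ ∈ cycInterval k t → t ≢ t′ →
  y ∉ cycInterval k t → y ∈ cycInterval k t′
cycIntervals-cover {m} k t t′ y k≤n t∈ t′∈ t≢t′ y∉ = subst (_∈ cycInterval k t′) y≡ (shift∈cycInterval k t′ (p ∸ d) p∸d<k)
  where
  d = pos t t′
  e = pos t′ t
  p = pos t y
  d<k : d < k
  d<k = ∈cycInterval⇒pos< k t t′ k≤n t′∈
  k≤p : k ≤ p
  k≤p = ≮⇒≥ (y∉ ∘ pos<⇒∈cycInterval k t y)
  t+d≡t′ : shift t d ≡ t′
  t+d≡t′ = shift-pos t t′
  t+d+e≡t : shift t (d + e) ≡ t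
  t+d+e≡t = trans (shift-+ t d e) (trans (cong (λ z → shift z e) t+d≡t′) (shift-pos t′ t))
  n≤d+e : suc m ≤ d + e
  n≤d+e = ≮⇒≥ λ lt → t≢t′ (sym (trans (sym t+d≡t′) (cong (shift t) (m+n≡0⇒m≡0 d (shift-injective t lt (s≤s z≤n) t+d+e≡t)))))
  p∸d<k : p ∸ d < k
  p∸d<k = ≤-<-trans (∸-monoˡ-≤ d (<⇒≤ (<-≤-trans (pos<n t y) n≤d+e)))
            (subst (_< k) (sym (m+n∸m≡n d e)) (∈cycInterval⇒pos< k t′ t k≤n t∈))
  y≡ : shift t′ (p ∸ d) ≡ y
  y≡ = trans (cong (λ z → shift z (p ∸ d)) (sym t+d≡t′)) (trans (sym (shift-+ t d (p ∸ d)))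
         (trans (cong (shift t) (m+[n∸m]≡n (≤-trans (<⇒≤ d<k) k≤p))) (shift-pos t y)))

module _ {m : ℕ} (k : ℕ) (2≤k : 2 ≤ k) (k+2≤n : k + 2 ≤ suc m) where

  private
    C = cycInterval {suc m} k
    k+1<n : suc k < suc m
    k+1<n = subst (_≤ suc m) (+-comm k 2) k+2≤n
    k≤n : k ≤ suc m
    k≤n = ≤-trans (n≤1+n k) (<⇒≤ k+1<n)

    next-of-overlap : ∀ t t′ a → t ∉ C t′ → (∀ x → x ∈ C t → x ≢ a → x ∈ C t′) → t′ ≡ next t
    next-of-overlap t t′ a t∉ C-a⊆ with t ≟ᶠ a
    ... | no t≢a = ⊥-elim (t∉ (C-a⊆ t (shift∈cycInterval k t 0 (≤-trans (s≤s z≤n) 2≤k)) t≢a))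
    ... | yes refl with next t ≟ᶠ t′
    ...   | yes eq  = sym eq
    ...   | no  ne  = ⊥-elim (t∉ (subst (_∈ C t′) (prev-next t) (prev∈cycInterval k t′ (next t) next∈ ne)))
      where
      next∈ : next t ∈ C t′
      next∈ = C-a⊆ (next t) (shift∈cycInterval k t 1 2≤k) (next≢ t (≤-trans 2≤k k≤n))

    module _ {t t′ a b} (eq : C t - a ≡ C t′ - b) where
      C-a⊆ : ∀ x → x ∈ C t → x ≢ a → x ∈ C t′
      C-a⊆ x x∈ x≢a = proj₁ (x∈p-y⁻ (subst (x ∈_) eq (x∈p∧x≢y⇒x∈p-y x∈ x≢a)))
      C′-b⊆ : ∀ x → x ∈ C t′ → x ≢ b → x ∈ C t
      C′-b⊆ x x∈ x≢b = proj₁ (x∈p-y⁻ (subst (x ∈_) (sym eq) (x∈p∧x≢y⇒x∈p-y x∈ x≢b)))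
      a∉C′ : a ≢ b → a ∉ C t′
      a∉C′ a≢b a∈C′ = proj₂ (x∈p-y⁻ (subst (a ∈_) (sym eq) (x∈p∧x≢y⇒x∈p-y a∈C′ a≢b))) refl

  cycInterval-adjacent : ∀ {t t′ a b} → a ≢ b → a ∈ C t → C t - a ≡ C t′ - b → t′ ≡ next t ⊎ t ≡ next t′
  cycInterval-adjacent {t} {t′} {a} {b} a≢b a∈ eq with t ∈? C t′ | t′ ∈? C t
  ... | no t∉     | _          = inj₁ (next-of-overlap t t′ a t∉ (C-a⊆ eq))
  ... | yes _     | no t′∉     = inj₂ (next-of-overlap t′ t b t′∉ (C′-b⊆ eq))
  ... | yes t∈C′  | yes t′∈C   = ⊥-elim (<⇒≱ k+1<n (begin
    suc m                  ≡⟨ ∣⊤∣≡n (suc m) ⟨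
    ∣ ⊤ {suc m} ∣          ≤⟨ p⊆q⇒∣p∣≤∣q∣ ⊤⊆ ⟩
    ∣ C t ∪ ⁅ b ⁆ ∣        ≤⟨ ∣p∪⁅x⁆∣≤1+∣p∣ (C t) b ⟩
    suc ∣ C t ∣            ≡⟨ cong suc (∣cycInterval∣ k t k≤n) ⟩
    suc k                  ∎))
    where
    open ≤-Reasoning
    t≢t′ : t ≢ t′
    t≢t′ refl = a∉C′ eq a≢b a∈
    ⊤⊆ : ⊤ {suc m} ⊆ C t ∪ ⁅ b ⁆
    ⊤⊆ {y} _ with y ∈? C t | y ≟ᶠ b
    ... | yes y∈ | _        = x∈p⇒x∈p∪⁅y⁆ y∈
    ... | no  _  | yes refl = y∈p∪⁅y⁆ y
    ... | no  y∉ | no  y≢b  = ⊥-elim (y∉ (C′-b⊆ eq y (cycIntervals-cover k t t′ y k≤n t∈C′ t′∈C t≢t′ y∉) y≢b))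

-- Matroids given by their bases

small-independent⇒Paving : ∀ {n} (B : Subset n → Set) r → (∀ X → ∣ X ∣ < r → Independent B X) → Paving B r
small-independent⇒Paving B r small C (C-dep , _) with r ≤? ∣ C ∣
... | yes r≤∣C∣ = r≤∣C∣
... | no  r≰∣C∣ = ⊥-elim (C-dep (small C (≰⇒> r≰∣C∣)))

module _ {n : ℕ} {B : Subset n → Set} (B? : ∀ Y → Dec (B Y)) where

  Independent? : ∀ X → Dec (Independent B X)
  Independent? X = anySubset? (λ Y → B? Y ×-dec (X ⊆? Y))

  Dependent⇒∃Circuit⊆ : ∀ c X → ∣ X ∣ ≤ c → Dependent B X → ∃ λ C → C ⊆ X × Circuit B C
  Dependent⇒∃Circuit⊆ c X ∣X∣≤c X-dep with anySubset? (λ Y → ((Y ⊆? X) ×-dec any? (λ x → (x ∈? X) ×-dec ¬? (x ∈? Y))) ×-dec ¬? (Independent? Y))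
  Dependent⇒∃Circuit⊆ zero    X ∣X∣≤0 X-dep | yes (Y , Y⊂X , _) = ⊥-elim (<⇒≱ (p⊂q⇒∣p∣<∣q∣ Y⊂X) (≤-trans ∣X∣≤0 z≤n))
  Dependent⇒∃Circuit⊆ (suc c) X ∣X∣≤c X-dep | yes (Y , Y⊂X , Y-dep)
    with Dependent⇒∃Circuit⊆ c Y (s≤s⁻¹ (≤-trans (p⊂q⇒∣p∣<∣q∣ Y⊂X) ∣X∣≤c)) Y-dep
  ... | C , C⊆Y , C-circuit = C , proj₁ Y⊂X ∘ C⊆Y , C-circuit
  Dependent⇒∃Circuit⊆ c X ∣X∣≤c X-dep | no ¬∃ = X , (λ h → h) , X-dep , proper-independent
    where
    proper-independent : ∀ Y → Y ⊂ X → Independent B Y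
    proper-independent Y Y⊂X with Independent? Y
    ... | yes Y-indep = Y-indep
    ... | no  Y-dep   = ⊥-elim (¬∃ (Y , Y⊂X , Y-dep))

  Paving⇒small-independent : ∀ r → Paving B r → ∀ X → ∣ X ∣ < r → Independent B X
  Paving⇒small-independent r paving X ∣X∣<r with Independent? X
  ... | yes X-indep = X-indep
  ... | no  X-dep with Dependent⇒∃Circuit⊆ ∣ X ∣ X ≤-refl X-dep
  ... | C , C⊆X , C-circuit = ⊥-elim (<⇒≱ (≤-<-trans (p⊆q⇒∣p∣≤∣q∣ C⊆X) ∣X∣<r) (paving C C-circuit))

module PavingMatroid {n : ℕ} (B : Subset n → Set) (k : ℕ) (basis-size : ∀ {Y} → B Y → ∣ Y ∣ ≡ suc k)
  (small-independent : ∀ X → ∣ X ∣ < suc k → Independent B X) where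

  nonbasis-dependent : ∀ {X} → ∣ X ∣ ≡ suc k → ¬ B X → Dependent B X
  nonbasis-dependent {X} ∣X∣≡ ¬BX (Y , BY , X⊆Y) =
    ¬BX (subst B (sym (⊆∧∣q∣≤∣p∣⇒≡ X⊆Y (≤-reflexive (trans (basis-size BY) (sym ∣X∣≡))))) BY)

  CircuitHyperplane⇒nonbasis : ∀ {X} → CircuitHyperplane B (suc k) X → ∣ X ∣ ≡ suc k × ¬ B X
  CircuitHyperplane⇒nonbasis {X} ((X-dep , X-minimal) , _ , _ , rank≤) = ≤-antisym ∣X∣≤ ≤∣X∣ , λ BX → X-dep (X , BX , λ h → h)
    where
    ≤∣X∣ : suc k ≤ ∣ X ∣
    ≤∣X∣ with suc k ≤? ∣ X ∣
    ... | yes ≤ = ≤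
    ... | no  ≰ = ⊥-elim (X-dep (small-independent X (≰⇒> ≰)))
    ∣X∣≤ : ∣ X ∣ ≤ suc k
    ∣X∣≤ with ∃∈ X (<-≤-trans (s≤s z≤n) ≤∣X∣)
    ... | x , x∈X = subst (_≤ suc k) (1+∣p-x∣≡∣p∣ X x x∈X)
          (s≤s (rank≤ (X - x) (p─q⊆p X ⁅ x ⁆) (X-minimal (X - x) (x∈p⇒p-x⊂p x∈X))))

  nonbasis⇒CircuitHyperplane : ∀ {X x} → ∣ X ∣ ≡ suc k → ¬ B X → x ∈ X → (∀ e → e ∉ X → B ((X - x) ∪ ⁅ e ⁆)) →
    CircuitHyperplane B (suc k) X
  nonbasis⇒CircuitHyperplane {X} {x} ∣X∣≡ ¬BX x∈X exchange =
    (X-dep , λ Y Y⊂X → small-independent Y (subst (∣ Y ∣ <_) ∣X∣≡ (p⊂q⇒∣p∣<∣q∣ Y⊂X))) ,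
    flat , (X - x , p─q⊆p X ⁅ x ⁆ , small-independent (X - x) (subst (_< suc k) (sym ∣X-x∣≡) ≤-refl) , ∣X-x∣≡) , rank≤
    where
    X-dep = nonbasis-dependent ∣X∣≡ ¬BX
    ∣X-x∣≡ : ∣ X - x ∣ ≡ k
    ∣X-x∣≡ = ∣p-x∣≡c x∈X ∣X∣≡
    rank≤ : ∀ Y → Y ⊆ X → Independent B Y → ∣ Y ∣ ≤ k
    rank≤ Y Y⊆X Y-indep with ∣ Y ∣ ≟ suc k
    ... | yes ∣Y∣≡ = ⊥-elim (X-dep (subst (Independent B) (⊆∧∣q∣≤∣p∣⇒≡ Y⊆X (≤-reflexive (trans ∣X∣≡ (sym ∣Y∣≡)))) Y-indep))
    ... | no  ∣Y∣≢ = s≤s⁻¹ (≤∧≢⇒< (subst (∣ Y ∣ ≤_) ∣X∣≡ (p⊆q⇒∣p∣≤∣q∣ Y⊆X)) ∣Y∣≢)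
    flat : Flat B X
    flat e e∉X _ _ ((Y , Y⊆X , Y-indep , refl) , _) (_ , rank≤′) = ≤-trans (s≤s (rank≤ Y Y⊆X Y-indep)) (begin
      suc k                     ≡⟨ cong suc ∣X-x∣≡ ⟨
      suc ∣ X - x ∣             ≡⟨ ∣p∪⁅x⁆∣≡1+∣p∣ (X - x) e (e∉X ∘ proj₁ ∘ x∈p-y⁻) ⟨
      ∣ (X - x) ∪ ⁅ e ⁆ ∣       ≤⟨ rank≤′ _ X-x+e⊆ (_ , exchange e e∉X , λ h → h) ⟩
      _                         ∎)
      where
      open ≤-Reasoning
      X-x+e⊆ : (X - x) ∪ ⁅ e ⁆ ⊆ X ∪ ⁅ e ⁆
      X-x+e⊆ h with x∈p∪⁅y⁆⁻ {p = X - x} h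
      ... | inj₁ h′   = x∈p⇒x∈p∪⁅y⁆ (proj₁ (x∈p-y⁻ h′))
      ... | inj₂ refl = y∈p∪⁅y⁆ e

-- The positroid of a Grassmann necklace

module Positroid {m : ℕ} (k′ : ℕ) (2≤k : 2 ≤ suc k′) (k+2≤n : suc k′ + 2 ≤ suc m)
  (I : Fin (suc m) → Subset (suc m)) (necklace : IsGrassmannNecklace I) (∣I∣≡k : ∀ t → ∣ I t ∣ ≡ suc k′) where

  private
    n = suc m
    k = suc k′
    k+1<n : suc k < n
    k+1<n = subst (_≤ n) (+-comm k 2) k+2≤n
    k<n : k < n
    k<n = <⇒≤ k+1<n
    k≤n : k ≤ n
    k≤n = <⇒≤ k<n
    k′≤n : k′ ≤ n
    k′≤n = ≤-trans (n≤1+n k′) k≤n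

  B : Subset n → Set
  B = PositroidBasis k I

  SchubertBasis? : ∀ t Y → Dec (SchubertBasis k t (I t) Y)
  SchubertBasis? t Y = (∣ Y ∣ ≟ k) ×-dec decidable (λ a b → pos t a ≤? pos t b) (sortedBy t (I t)) (sortedBy t Y)

  B? : ∀ Y → Dec (B Y)
  B? Y = all? λ t → SchubertBasis? t Y

  prefix⊆∧both∈-absurd : ∀ t → cycInterval k′ t ⊆ I t → shift t k′ ∈ I t → shift t k ∉ I t
  prefix⊆∧both∈-absurd t pre last∈ next∈ = <-irrefl refl (begin-strict
    k                         <⟨ n<1+n k ⟩
    suc k                     ≡⟨ ∣cycInterval∣ (suc k) t k<n ⟨
    ∣ cycInterval (suc k) t ∣ ≤⟨ p⊆q⇒∣p∣≤∣q∣ C⊆ ⟩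
    ∣ I t ∣                   ≡⟨ ∣I∣≡k t ⟩
    k                         ∎)
    where
    open ≤-Reasoning
    C⊆ : cycInterval (suc k) t ⊆ I t
    C⊆ {x} x∈ with ∈cycInterval-suc⁻ k t x x∈
    ... | inj₂ refl = next∈
    ... | inj₁ x∈C with ∈cycInterval-suc⁻ k′ t x x∈C
    ...   | inj₁ x∈C′ = pre x∈C′
    ...   | inj₂ refl = last∈

  ⊆suffix∧both∉-absurd : ∀ t → I t ⊆ cycInterval (suc k) t → shift t k′ ∉ I t → shift t k ∈ I t
  ⊆suffix∧both∉-absurd t suf last∉ = decidable-stable (shift t k ∈? I t) λ next∉ → <-irrefl refl (begin-strict
    k′                        <⟨ n<1+n k′ ⟩
    k                         ≡⟨ ∣I∣≡k t ⟨
    ∣ I t ∣                   ≤⟨ p⊆q⇒∣p∣≤∣q∣ (⊆C next∉) ⟩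
    ∣ cycInterval k′ t ∣      ≡⟨ ∣cycInterval∣ k′ t k′≤n ⟩
    k′                        ∎)
    where
    open ≤-Reasoning
    ⊆C : shift t k ∉ I t → I t ⊆ cycInterval k′ t
    ⊆C next∉ {x} x∈ with ∈cycInterval-suc⁻ k t x (suf x∈)
    ... | inj₂ refl = ⊥-elim (next∉ x∈)
    ... | inj₁ x∈C with ∈cycInterval-suc⁻ k′ t x x∈C
    ...   | inj₁ x∈C′ = x∈C′
    ...   | inj₂ refl = ⊥-elim (last∉ x∈)

  -- Between C_{k-1}^{(t)} and C_{k+1}^{(t)}, a k-set must contain exactly one of t+k-1 and t+k.
  interval⊎bumped : ∀ t → cycInterval k′ t ⊆ I t → I t ⊆ cycInterval (suc k) t →
    I t ≡ cycInterval k t ⊎ I t ≡ bumpedInterval k t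
  interval⊎bumped t pre suf with shift t k′ ∈? I t
  ... | yes last∈ = inj₁ (⊆-antisym ⊆C C⊆)
    where
    next∉ = prefix⊆∧both∈-absurd t pre last∈
    ⊆C : I t ⊆ cycInterval k t
    ⊆C {x} x∈ with ∈cycInterval-suc⁻ k t x (suf x∈)
    ... | inj₁ x∈C  = x∈C
    ... | inj₂ refl = ⊥-elim (next∉ x∈)
    C⊆ : cycInterval k t ⊆ I t
    C⊆ {x} x∈ with ∈cycInterval-suc⁻ k′ t x x∈
    ... | inj₁ x∈C  = pre x∈C
    ... | inj₂ refl = last∈
  ... | no  last∉ = inj₂ (⊆-antisym ⊆B B⊆)
    where
    next∈ = ⊆suffix∧both∉-absurd t suf last∉
    ⊆B : I t ⊆ bumpedInterval k t
    ⊆B {x} x∈ with ∈cycInterval-suc⁻ k t x (suf x∈)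
    ... | inj₁ x∈C  = x∈p⇒x∈p∪⁅y⁆ (x∈p∧x≢y⇒x∈p-y x∈C λ { refl → last∉ x∈ })
    ... | inj₂ refl = y∈p∪⁅y⁆ x
    B⊆ : bumpedInterval k t ⊆ I t
    B⊆ x∈ with ∈bumpedInterval⁻ k′ t k<n x∈
    ... | inj₁ x∈C  = pre x∈C
    ... | inj₂ refl = next∈

  independent⇒prefix⊆ : ∀ t → Independent B (cycInterval k′ t) → cycInterval k′ t ⊆ I t
  independent⇒prefix⊆ t (Y , BY , C⊆Y) = GaleLe-prefix k′ t (I t) Y k′≤n (proj₂ (BY t)) C⊆Y

  dualIndependent⇒⊆suffix : ∀ t → Independent (dualBases B) (∁ (cycInterval (suc k) t)) → I t ⊆ cycInterval (suc k) t
  dualIndependent⇒⊆suffix t (Y , B∁Y , ∁C⊆Y) = GaleLe-suffix (suc k) t (I t) (∁ Y) k<n (proj₂ (B∁Y t))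
    λ x∈∁Y → x∉∁p⇒x∈p λ x∈∁C → x∈∁p⇒x∉p x∈∁Y (∁C⊆Y x∈∁C)

  -- After a bumped step t ↦ t+1 the element t+k survives into I(t+1), where a bumped interval cannot have it.
  bumped-not-consecutive : ∀ t → I t ≡ bumpedInterval k t → I (next t) ≢ bumpedInterval k (next t)
  bumped-not-consecutive t It≡ It+1≡ = shift∉bumpedInterval k′ (next t) k<n (subst (shift t k ∈_) It+1≡ t+k∈It+1)
    where
    t∈It : t ∈ I t
    t∈It = subst (t ∈_) (sym It≡) (cycInterval⊆bumpedInterval k′ t k<n (shift∈cycInterval k′ t 0 (s≤s⁻¹ 2≤k)))
    t+k≢t : shift t k ≢ t
    t+k≢t eq = 1+n≢0 (shift-injective t k<n (s≤s z≤n) eq)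
    t+k∈It+1 : shift t k ∈ I (next t)
    t+k∈It+1 with proj₁ (necklace t) t∈It
    ... | _ , It+1≡It-t+j = subst (shift t k ∈_) (sym It+1≡It-t+j)
          (x∈p⇒x∈p∪⁅y⁆ (x∈p∧x≢y⇒x∈p-y (subst (shift t k ∈_) (sym It≡) (y∈p∪⁅y⁆ (shift t k))) t+k≢t))

  SparsePaving⇒interval⊎bumped : SparsePaving B k → ∀ t → I t ≡ cycInterval k t ⊎ I t ≡ bumpedInterval k t
  SparsePaving⇒interval⊎bumped (paving , dual-paving) t = interval⊎bumped t
    (independent⇒prefix⊆ t (Paving⇒small-independent B? k paving _ ∣C∣<))
    (dualIndependent⇒⊆suffix t (Paving⇒small-independent (B? ∘ ∁) (n ∸ k) dual-paving _ ∣∁C∣<))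
    where
    ∣C∣< : ∣ cycInterval k′ t ∣ < k
    ∣C∣< = subst (_< k) (sym (∣cycInterval∣ k′ t k′≤n)) ≤-refl
    ∣∁C∣< : ∣ ∁ (cycInterval (suc k) t) ∣ < n ∸ k
    ∣∁C∣< = subst (_< n ∸ k) (sym (trans (∣∁p∣≡n∸∣p∣ (cycInterval (suc k) t)) (cong (n ∸_) (∣cycInterval∣ (suc k) t k<n))))
              (∸-monoʳ-< (n<1+n k) k<n)

  SparsePaving⇒NecklaceCond : SparsePaving B k → NecklaceCond k I
  SparsePaving⇒NecklaceCond sp i Ii≢C = interval-unless-bumped (prev i) (λ ≡B → bumped-not-consecutive (prev i) ≡B Ii≡B′)
                                      , interval-unless-bumped (next i) (bumped-not-consecutive i Ii≡B)
                                      , Ii≡B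
    where
    interval-unless-bumped : ∀ t → I t ≢ bumpedInterval k t → I t ≡ cycInterval k t
    interval-unless-bumped t ≢B = [ id , ⊥-elim ∘ ≢B ]′ (SparsePaving⇒interval⊎bumped sp t)
    Ii≡B : I i ≡ bumpedInterval k i
    Ii≡B = [ ⊥-elim ∘ Ii≢C , id ]′ (SparsePaving⇒interval⊎bumped sp i)
    Ii≡B′ : I (next (prev i)) ≡ bumpedInterval k (next (prev i))
    Ii≡B′ = subst (λ s → I s ≡ bumpedInterval k s) (sym (next-prev i)) Ii≡B

  module FromNecklaceCond (cond : NecklaceCond k I) where

    Defective : Fin n → Set
    Defective t = I t ≢ cycInterval k t

    private
      _≟ˢ_ : (X Y : Subset n) → Dec (X ≡ Y)
      _≟ˢ_ = ≡-dec _≟ᵇ_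

    defective⇒bumped : ∀ {t} → Defective t → I t ≡ bumpedInterval k t
    defective⇒bumped {t} d = proj₂ (proj₂ (cond t d))

    defective-not-adjacent : ∀ {t t′} → Defective t → Defective t′ → t′ ≡ next t ⊎ t ≡ next t′ → ⊥
    defective-not-adjacent {t} dt dt′ (inj₁ refl) = dt′ (proj₁ (proj₂ (cond t dt)))
    defective-not-adjacent {_} {t′} dt dt′ (inj₂ refl) = dt (proj₁ (proj₂ (cond t′ dt′)))

    I≤ : ∀ t Y → ∣ Y ∣ ≡ k → (Defective t → Y ≢ cycInterval k t) → GaleLe t (I t) Y
    I≤ t Y ∣Y∣≡k Y≢ with I t ≟ˢ cycInterval k t
    ... | yes It≡C = subst (λ Z → GaleLe t Z Y) (sym It≡C) (cycInterval-GaleLe k t Y k≤n ∣Y∣≡k)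
    ... | no  d    = subst (λ Z → GaleLe t Z Y) (sym (defective⇒bumped d)) (bumpedInterval-GaleLe k′ t Y k<n ∣Y∣≡k (Y≢ d))

    nonbasis⇒defectiveInterval : ∀ Y → ∣ Y ∣ ≡ k → ¬ B Y → ∃ λ t → Defective t × Y ≡ cycInterval k t
    nonbasis⇒defectiveInterval Y ∣Y∣≡k ¬BY with ¬∀⟶∃¬ n (λ t → SchubertBasis k t (I t) Y) (λ t → SchubertBasis? t Y) ¬BY
    ... | t , ¬SBt with I t ≟ˢ cycInterval k t | Y ≟ˢ cycInterval k t
    ...   | yes It≡C | _        = ⊥-elim (¬SBt (∣Y∣≡k , subst (λ Z → GaleLe t Z Y) (sym It≡C) (cycInterval-GaleLe k t Y k≤n ∣Y∣≡k)))
    ...   | no  d    | yes Y≡C  = t , d , Y≡C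
    ...   | no  d    | no  Y≢C  = ⊥-elim (¬SBt (∣Y∣≡k , I≤ t Y ∣Y∣≡k (λ _ → Y≢C)))

    defective-nonbasis : ∀ {t} → Defective t → ¬ B (cycInterval k t)
    defective-nonbasis {t} d BC = bumpedInterval-¬GaleLe-cycInterval k′ t k<n
      (subst (λ Z → GaleLe t Z (cycInterval k t)) (defective⇒bumped d) (proj₂ (BC t)))

    -- Two non-bases related by one exchange would be intervals at adjacent defective indices.
    exchange-basis : ∀ {X₁ X₂ a b} → a ≢ b → a ∈ X₁ → b ∈ X₂ → ∣ X₁ ∣ ≡ k → X₁ - a ≡ X₂ - b → B X₁ ⊎ B X₂
    exchange-basis {X₁} {X₂} a≢b a∈ b∈ ∣X₁∣≡k eq with B? X₁ | B? X₂
    ... | yes BX₁ | _       = inj₁ BX₁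
    ... | no  _   | yes BX₂ = inj₂ BX₂
    ... | no ¬BX₁ | no ¬BX₂ with nonbasis⇒defectiveInterval X₁ ∣X₁∣≡k ¬BX₁
                               | nonbasis⇒defectiveInterval X₂ (trans (sym (p-x≡q-y⇒∣p∣≡∣q∣ a∈ b∈ eq)) ∣X₁∣≡k) ¬BX₂
    ... | t , dt , refl | t′ , dt′ , refl = ⊥-elim (defective-not-adjacent dt dt′ (cycInterval-adjacent k 2≤k k+2≤n a≢b a∈ eq))

    small-independent : ∀ X → ∣ X ∣ < k → Independent B X
    small-independent X ∣X∣<k with ⊆-extend X k′ (s≤s⁻¹ ∣X∣<k) k′≤n
    ... | Z , X⊆Z , ∣Z∣≡k′ with ∃∉ Z (subst (_< n) (sym ∣Z∣≡k′) (≤-trans (n≤1+n k) k<n))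
    ... | a , a∉Z with ∃∉ (Z ∪ ⁅ a ⁆) (subst (_< n) (sym (trans (∣p∪⁅x⁆∣≡1+∣p∣ Z a a∉Z) (cong suc ∣Z∣≡k′))) k<n)
    ... | b , b∉Z+a with exchange-basis {Z ∪ ⁅ a ⁆} {Z ∪ ⁅ b ⁆} (λ { refl → b∉Z+a (y∈p∪⁅y⁆ a) }) (y∈p∪⁅y⁆ a) (y∈p∪⁅y⁆ b)
                           (trans (∣p∪⁅x⁆∣≡1+∣p∣ Z a a∉Z) (cong suc ∣Z∣≡k′))
                           (trans (p∪⁅x⁆-x≡p Z a a∉Z) (sym (p∪⁅x⁆-x≡p Z b (b∉Z+a ∘ x∈p⇒x∈p∪⁅y⁆))))
    ... | inj₁ BZ+a = Z ∪ ⁅ a ⁆ , BZ+a , x∈p⇒x∈p∪⁅y⁆ ∘ X⊆Z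
    ... | inj₂ BZ+b = Z ∪ ⁅ b ⁆ , BZ+b , x∈p⇒x∈p∪⁅y⁆ ∘ X⊆Z

    dual-independent : ∀ {W W′ Y} → W ⊆ W′ → Y ⊆ ∁ W′ → B Y → Independent (dualBases B) W
    dual-independent {Y = Y} W⊆W′ Y⊆∁W′ BY =
      ∁ Y , subst B (sym (∁-involutive Y)) BY , λ w∈W → x∉p⇒x∈∁p λ w∈Y → x∈∁p⇒x∉p (Y⊆∁W′ w∈Y) (W⊆W′ w∈W)

    dual-small-independent : ∀ W → ∣ W ∣ < n ∸ k → Independent (dualBases B) W
    dual-small-independent W ∣W∣< with ⊆-extend W (n ∸ suc k) (s≤s⁻¹ (subst (∣ W ∣ <_) (+-∸-assoc 1 k<n) ∣W∣<)) (m∸n≤m n (suc k))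
    ... | W′ , W⊆W′ , ∣W′∣≡ with ∃∈ (∁ W′) (subst (0 <_) (sym (∣p∣≡n∸c⇒∣∁p∣≡c W′ k<n ∣W′∣≡)) (s≤s z≤n))
    ... | a , a∈Z with ∃∈ (∁ W′ - a) (subst (0 <_) (sym (∣p-x∣≡c a∈Z (∣p∣≡n∸c⇒∣∁p∣≡c W′ k<n ∣W′∣≡))) (s≤s z≤n))
    ... | b , b∈Z-a with exchange-basis {∁ W′ - a} {∁ W′ - b} (proj₂ (x∈p-y⁻ b∈Z-a)) b∈Z-a
                           (x∈p∧x≢y⇒x∈p-y a∈Z (proj₂ (x∈p-y⁻ b∈Z-a) ∘ sym))
                           (∣p-x∣≡c a∈Z (∣p∣≡n∸c⇒∣∁p∣≡c W′ k<n ∣W′∣≡))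
                           (p─x─y≡p─y─x (∁ W′) a b)
    ... | inj₁ BZ-a = dual-independent W⊆W′ (p─q⊆p (∁ W′) ⁅ a ⁆) BZ-a
    ... | inj₂ BZ-b = dual-independent W⊆W′ (p─q⊆p (∁ W′) ⁅ b ⁆) BZ-b

    sparsePaving : SparsePaving B k
    sparsePaving = small-independent⇒Paving B k small-independent , small-independent⇒Paving (dualBases B) (n ∸ k) dual-small-independent

    open PavingMatroid B k′ (λ BY → proj₁ (BY fzero)) small-independent

    CircuitHyperplane⇔defectiveInterval : ∀ X → CircuitHyperplane B k X ⇔ (∃ λ i → Defective i × X ≡ cycInterval k i)
    CircuitHyperplane⇔defectiveInterval X = mk⇔
      (λ CH → let ∣X∣≡k , ¬BX = CircuitHyperplane⇒nonbasis CH in nonbasis⇒defectiveInterval X ∣X∣≡k ¬BX)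
      λ { (i , d , refl) → nonbasis⇒CircuitHyperplane (∣cycInterval∣ k i k≤n) (defective-nonbasis d) (i∈C i) (exchange i d) }
      where
      i∈C : ∀ i → i ∈ cycInterval k i
      i∈C i = shift∈cycInterval k i 0 (s≤s z≤n)
      exchange : ∀ i → Defective i → ∀ e → e ∉ cycInterval k i → B ((cycInterval k i - i) ∪ ⁅ e ⁆)
      exchange i d e e∉C with exchange-basis (λ { refl → e∉C (i∈C i) }) (i∈C i) (y∈p∪⁅y⁆ e) (∣cycInterval∣ k i k≤n)
                                (sym (p∪⁅x⁆-x≡p (cycInterval k i - i) e (e∉C ∘ proj₁ ∘ x∈p-y⁻)))
      ... | inj₁ BC  = ⊥-elim (defective-nonbasis d BC)
      ... | inj₂ BC′ = BC′

  SparsePaving⇔NecklaceCond : SparsePaving B k ⇔ NecklaceCond k I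
  SparsePaving⇔NecklaceCond = mk⇔ SparsePaving⇒NecklaceCond FromNecklaceCond.sparsePaving

mainTheorem1 : (n k : ℕ) → 2 ≤ k → k + 2 ≤ n →
    (I : Fin n → Subset n) → IsGrassmannNecklace I → (∀ t → ∣ I t ∣ ≡ k) →
      (SparsePaving (PositroidBasis k I) k ⇔ NecklaceCond k I)
    × (SparsePaving (PositroidBasis k I) k →
        ∀ (X : Subset n) →
          CircuitHyperplane (PositroidBasis k I) k X
            ⇔ (∃ λ (i : Fin n) → ¬ (I i ≡ cycInterval k i) × X ≡ cycInterval k i))
mainTheorem1 zero (suc (suc _)) _ ()
mainTheorem1 (suc m) (suc k′) 2≤k k+2≤n I necklace ∣I∣≡k =
  SparsePaving⇔NecklaceCond , λ sp → FromNecklaceCond.CircuitHyperplane⇔defectiveInterval (SparsePaving⇒NecklaceCond sp)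
  where open Positroid k′ 2≤k k+2≤n I necklace ∣I∣≡k
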